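{- Assume that $d_n^2 < 2p_n$ for every integer $n\geq 1$ with $n\neq 4$. Then for every $n\geq 1$, $d_n \leq 2\lfloor\sqrt{p_n}\rfloor$. Moreover, if $d_n = 2\lfloor\sqrt{p_n}\rfloor$ then $\lfloor\sqrt{p_{n+1}}\rfloor = \lfloor\sqrt{p_n}\rfloor + 1$.
   Context: $p_n$ denotes the $n$th prime ($p_1=2$), $d_n := p_{n+1}-p_n$, and $\lfloor x\rfloor$ is the integer part of $x$. -}

module Defs where

open import Data.Nat using (ℕ; zero; suc; _+_; _*_; _≤?_)
open import Data.Nat.Primality using (prime?)
open import Relation.Nullary.Decidable using (does)
open import Data.Bool using (if_then_else_)

πlt : ℕ → ℕ
πlt zero    = zero
πlt (suc m) = if does (prime? m) then suc (πlt m) else πlt m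

isqrt : ℕ → ℕ
isqrt zero    = zero
isqrt (suc x) with isqrt x
... | s = if does (suc s * suc s ≤? suc x) then suc s else s

{-# OPTIONS --safe #-}
-- Let s = ⌊√p⌋, so that p < (s + 1)². Then d² < 2p ≤ 2(s + 1)² − 2 ≤ (2s + 1)² − 1, i.e.
-- d ≤ 2s; at n = 4, where the hypothesis is not available, d₄ = 11 − 7 = 4 = 2⌊√7⌋.
-- If d = 2s, then s² < p because a prime is not a square, and hence
-- (s + 1)² ≤ p + 2s = q < (s + 1)² + 2s ≤ (s + 2)².
module Submission where

open import Defs
open import Data.Nat using (ℕ; zero; suc; _+_; _*_; _∸_; _≤_; _<_; _≤′_; _≤?_; _≟_; z≤n; s≤s; ≤′-refl; ≤′-step; >-nonZero)
open import Data.Nat.Properties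
open import Data.Nat.Primality using (Prime; prime?; prime⇒¬composite; composite-≢; composite⇒¬prime; composite[6]; ¬prime[0]; ¬prime[1])
open import Data.Nat.Divisibility using (divides-refl)
open import Data.Nat.Tactic.RingSolver using (solve-∀)
open import Data.Bool using (true; false; if_then_else_)
open import Data.Product using (_×_; _,_; proj₁; proj₂)
open import Relation.Nullary using (Dec; yes; no; does; contradiction)
open import Relation.Binary.Core using (_Preserves_⟶_)
open import Relation.Binary.PropositionalEquality using (_≡_; _≢_; refl; sym; trans; cong)

m*m<n*n⇒m<n : ∀ {m n} → m * m < n * n → m < n
m*m<n*n⇒m<n m*m<n*n = ≰⇒> (λ n≤m → <⇒≱ m*m<n*n (*-mono-≤ n≤m n≤m))

prime⇒¬square : ∀ {p} m → Prime p → m * m ≢ p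
prime⇒¬square 0 p-prime refl = ¬prime[0] p-prime
prime⇒¬square 1 p-prime refl = ¬prime[1] p-prime
prime⇒¬square m@(suc (suc _)) p-prime refl =
  prime⇒¬composite p-prime (composite-≢ m (<⇒≢ (m<m*n m m (s≤s (s≤s z≤n)))) (divides-refl m))

isqrt-bounds : ∀ x → isqrt x * isqrt x ≤ x × x < suc (isqrt x) * suc (isqrt x)
isqrt-bounds zero = z≤n , s≤s z≤n
isqrt-bounds (suc x) with isqrt x | isqrt-bounds x
... | s | s*s≤x , x<[1+s]² = step (suc s * suc s ≤? suc x)
  where
  step : (D : Dec (suc s * suc s ≤ suc x)) →
         let r = if does D then suc s else s in r * r ≤ suc x × suc x < suc r * suc r
  step (yes [1+s]²≤1+x) = [1+s]²≤1+x , ≤-<-trans x<[1+s]² (*-mono-< (n<1+n (suc s)) (n<1+n (suc s)))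
  step (no  [1+s]²≰1+x) = m≤n⇒m≤1+n s*s≤x , ≰⇒> [1+s]²≰1+x

isqrt-lower : ∀ x → isqrt x * isqrt x ≤ x
isqrt-lower x = proj₁ (isqrt-bounds x)

isqrt-upper : ∀ x → x < suc (isqrt x) * suc (isqrt x)
isqrt-upper x = proj₂ (isqrt-bounds x)

isqrt-unique : ∀ {r x} → r * r ≤ x → x < suc r * suc r → isqrt x ≡ r
isqrt-unique {r} {x} r*r≤x x<[1+r]² = ≤-antisym
  (≤-pred (m*m<n*n⇒m<n (≤-<-trans (isqrt-lower x) x<[1+r]²)))
  (≤-pred (m*m<n*n⇒m<n (≤-<-trans r*r≤x (isqrt-upper x))))

square<2*⇒≤2*isqrt : ∀ {d x} → d * d < 2 * x → d ≤ 2 * isqrt x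
square<2*⇒≤2*isqrt {d} {x} d*d<2x =
  ≤-pred (m*m<n*n⇒m<n (<-trans (n<1+n (d * d)) (≤-pred bound)))
  where
  open ≤-Reasoning
  s = isqrt x
  bound : 3 + d * d ≤ suc (suc (2 * s) * suc (2 * s))
  bound = begin
    3 + d * d                          ≤⟨ +-monoʳ-≤ 2 d*d<2x ⟩
    2 + 2 * x                          ≡⟨ sym (*-distribˡ-+ 2 1 x) ⟩
    2 * suc x                          ≤⟨ *-monoʳ-≤ 2 (isqrt-upper x) ⟩
    2 * (suc s * suc s)                ≤⟨ m≤m+n _ (2 * (s * s)) ⟩
    2 * (suc s * suc s) + 2 * (s * s)  ≡⟨ identity s ⟩
    suc (suc (2 * s) * suc (2 * s))    ∎
    where
    identity : ∀ s → 2 * (suc s * suc s) + 2 * (s * s) ≡ suc (suc (2 * s) * suc (2 * s))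
    identity = solve-∀

isqrt[2*isqrt+x]≡isqrt+1 : ∀ {x} → isqrt x * isqrt x ≢ x → isqrt (2 * isqrt x + x) ≡ isqrt x + 1
isqrt[2*isqrt+x]≡isqrt+1 {x} non-square = isqrt-unique lower upper
  where
  open ≤-Reasoning
  s = isqrt x
  lower : (s + 1) * (s + 1) ≤ 2 * s + x
  lower = begin
    (s + 1) * (s + 1)    ≡⟨ identity s ⟩
    2 * s + suc (s * s)  ≤⟨ +-monoʳ-≤ (2 * s) (≤∧≢⇒< (isqrt-lower x) non-square) ⟩
    2 * s + x            ∎
    where
    identity : ∀ s → (s + 1) * (s + 1) ≡ 2 * s + suc (s * s)
    identity = solve-∀
  upper : 2 * s + x < suc (s + 1) * suc (s + 1)
  upper = begin-strict
    2 * s + x                  <⟨ +-monoʳ-< (2 * s) (isqrt-upper x) ⟩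
    2 * s + suc s * suc s      ≤⟨ m≤m+n _ 3 ⟩
    2 * s + suc s * suc s + 3  ≡⟨ identity s ⟩
    suc (s + 1) * suc (s + 1)  ∎
    where
    identity : ∀ s → 2 * s + suc s * suc s + 3 ≡ suc (s + 1) * suc (s + 1)
    identity = solve-∀

πlt[n]≤πlt[1+n] : ∀ n → πlt n ≤ πlt (suc n)
πlt[n]≤πlt[1+n] n with does (prime? n)
... | true  = n≤1+n (πlt n)
... | false = ≤-refl

πlt-mono-≤ : πlt Preserves _≤_ ⟶ _≤_
πlt-mono-≤ m≤n = mono′ (≤⇒≤′ m≤n)
  where
  mono′ : ∀ {m n} → m ≤′ n → πlt m ≤ πlt n
  mono′ ≤′-refl                    = ≤-refl
  mono′ {n = suc n} (≤′-step m≤′n) = ≤-trans (mono′ m≤′n) (πlt[n]≤πlt[1+n] n)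

πlt-cancel-< : ∀ {m n} → πlt m < πlt n → m < n
πlt-cancel-< πlt[m]<πlt[n] = ≰⇒> (λ n≤m → <⇒≱ πlt[m]<πlt[n] (πlt-mono-≤ n≤m))

fourth-prime : ∀ {p} → Prime p → πlt p ≡ 3 → p ≡ 7
fourth-prime {0} _ ()
fourth-prime {1} _ ()
fourth-prime {2} _ ()
fourth-prime {3} _ ()
fourth-prime {4} _ ()
fourth-prime {5} _ ()
fourth-prime {6} p-prime _ = contradiction p-prime (composite⇒¬prime composite[6])
fourth-prime {7} _ _ = refl
fourth-prime {suc (suc (suc (suc (suc (suc (suc (suc k)))))))} _ πlt[p]≡3 =
  contradiction (πlt-cancel-< (≤-reflexive (cong suc πlt[p]≡3))) (m+n≮m 8 k)

fourth-gap-bound : ∀ {p q} → Prime p → πlt p ≡ 3 → πlt q ≡ 4 → q ∸ p ≤ 2 * isqrt p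
fourth-gap-bound {q = q} p-prime πlt[p]≡3 πlt[q]≡4 rewrite fourth-prime p-prime πlt[p]≡3 =
  ∸-monoˡ-≤ 7 (≤-pred (πlt-cancel-< {q} {12} (≤-reflexive (cong suc πlt[q]≡4))))

theorem6p1 :
    (∀ (n p q : ℕ) → 1 ≤ n → n ≢ 4 →
      Prime p → πlt p ≡ n ∸ 1 → Prime q → πlt q ≡ n →
      (q ∸ p) * (q ∸ p) < 2 * p) →
    ∀ (n p q : ℕ) → 1 ≤ n →
      Prime p → πlt p ≡ n ∸ 1 → Prime q → πlt q ≡ n →
      (q ∸ p ≤ 2 * isqrt p)
      × (q ∸ p ≡ 2 * isqrt p → isqrt q ≡ isqrt p + 1)
theorem6p1 hyp n p q 1≤n p-prime πlt[p]≡n-1 q-prime πlt[q]≡n = gap-bound , gap-equality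
  where
  gap-bound : q ∸ p ≤ 2 * isqrt p
  gap-bound with n ≟ 4
  ... | no  n≢4 = square<2*⇒≤2*isqrt {x = p} (hyp n p q 1≤n n≢4 p-prime πlt[p]≡n-1 q-prime πlt[q]≡n)
  ... | yes refl = fourth-gap-bound p-prime πlt[p]≡n-1 πlt[q]≡n

  p<q : p < q
  p<q = πlt-cancel-< (≤-reflexive (trans (cong suc πlt[p]≡n-1) (trans (suc-pred n) (sym πlt[q]≡n))))
    where instance _ = >-nonZero 1≤n

  gap-equality : q ∸ p ≡ 2 * isqrt p → isqrt q ≡ isqrt p + 1
  gap-equality d≡2s = trans (cong isqrt q≡2s+p) (isqrt[2*isqrt+x]≡isqrt+1 (prime⇒¬square (isqrt p) p-prime))
    where
    q≡2s+p : q ≡ 2 * isqrt p + p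
    q≡2s+p = trans (sym (m∸n+n≡m (<⇒≤ p<q))) (cong (_+ p) d≡2s)
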